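{- Let $\Sigma=(\Delta,A,\sigma,\varrho,F)$ be a nominal residual signature and let $\mathcal{R}$ be a nominal residual transition system specification (NRTSS) over $\Sigma$. If $\mathcal{R}$ is in equivariant format, then $\mathcal{R}$ induces a nominal residual transition system; that is, the transition relation ${\to}\subseteq \mathrm{NT}(\sigma)\times\mathrm{NT}(\varrho)$ consisting of all transitions provable in $\mathcal{R}$ is equivariant: whenever $P\to R$ is provable in $\mathcal{R}$, then $\pi\cdot P\to\pi\cdot R$ is provable in $\mathcal{R}$ for every permutation $\pi$.
   Context: Atoms and nominal sets. Fix a countable set $A$ of atom sorts and pairwise disjoint countably infinite sets $\mathbb{A}_\alpha$ ($\alpha\in A$) of atoms; $\mathbb{A}=\bigcup_\alpha\mathbb{A}_\alpha$. A permutation is a bijection of $\mathbb{A}$ moving only finitely many atoms and mapping each $\mathbb{A}_\alpha$ onto itself; $\iota$ is the identity and $(a\ b)$ (for $a,b$ of the same sort) is the transposition swapping $a$ and $b$. An action of permutations on a set $S$ is a map $(\pi,s)\mapsto\pi\cdot s$ with $\iota\cdot s=s$ and $(\pi_1\circ\pi_2)\cdot s=\pi_1\cdot(\pi_2\cdot s)$. A set $B\subseteq\mathbb{A}$ supports $s$ if $\pi\cdot s=s$ for every $\pi$ fixing each element of $B$; a nominal set is a set with such an action in which every element has a finite support; $\mathrm{supp}(s)$ is the least finite support. Atoms act by $\pi\cdot a=\pi(a)$, products componentwise, disjoint unions summandwise. $s_1\# s_2$ ("fresh") iff $\mathrm{supp}(s_1)\cap\mathrm{supp}(s_2)=\emptyset$.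 A function/relation is equivariant if it commutes with / is closed under the action of every permutation. For $a\in\mathbb{A}_\alpha$ and $s$ in a nominal set, the atom abstraction is $\langle a\rangle s=\{(b,(b\ a)\cdot s)\mid b\in\mathbb{A}_\alpha,\ b=a\text{ or }b\# s\}$, with $\pi\cdot\langle a\rangle s=\langle\pi(a)\rangle(\pi\cdot s)$; $[\mathbb{A}_\alpha]S$ is the nominal set of such abstractions of elements of $S$. Renamings. A renaming is a map $\rho:\mathbb{A}\to\mathbb{A}$ mapping each $\mathbb{A}_\alpha$ into itself and fixing all but finitely many atoms; $\rho_1;\rho_2$ denotes $\rho_2\circ\rho_1$. Renamings form a nominal set with $\pi\cdot\rho=\pi^{ -1};\rho;\pi$. Signatures and raw terms. A nominal signature is $(\Delta,A,F)$ with $\Delta=\{\delta_1,\dots,\delta_n\}$ finite (base sorts) and $F$ a finite set of function symbols $f_{ij}:\sigma_{ij}\to\delta_i$ ($1\le i\le n$, $1\le j\le m_i$), sorts being $\sigma::=\delta\mid\alpha\mid[\alpha]\sigma\mid\sigma_1\times\cdots\times\sigma_k$ ($k\ge0$). For each sort there are countably many variables. Raw terms (sort-correctly) are: variables $x$; atoms $a$; moderated terms $\mathrm{mod}(t,\rho)$ ($t$ a raw term, $\rho$ a renaming; same sort as $t$); abstractions $[a]t$ of sort $[\alpha]\sigma$ ($a\in\mathbb{A}_\alpha$, $t$ of sort $\sigma$); tuples $(t_1,\dots,t_k)$; and $f(t)$. A term is ground if it has no variables. Permutations act on raw terms by $\pi\cdot x=x$, $\pi\cdot a=\pi(a)$,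 $\pi\cdot\mathrm{mod}(t,\rho)=\mathrm{mod}(\pi\cdot t,\pi\cdot\rho)$, $\pi\cdot[a]t=[\pi(a)](\pi\cdot t)$, componentwise on tuples and $f(t)$. The renaming action $t[\rho]$ is: $x[\rho]=x$, $a[\rho]=\rho(a)$, $\mathrm{mod}(t,\rho_1)[\rho]=\mathrm{mod}(t,\rho_1;\rho)$, $([a]t)[\rho]=[\rho(a)](t[\rho])$, componentwise on tuples and $f(t)$. A substitution is a sort-preserving finitely supported map $\varphi$ from variables to raw terms, extended by $\varphi(a)=a$, $\varphi(\mathrm{mod}(t,\rho))=\mathrm{mod}(\varphi(t),\rho)$, $\varphi([a]t)=[a]\varphi(t)$ and homomorphically otherwise; it is ground if each $\varphi(x)\neq x$ is ground. Nominal terms. Let $\mathrm{NT}(\alpha)=\mathbb{A}_\alpha$, $\mathrm{NT}([\alpha]\sigma)=[\mathbb{A}_\alpha]\mathrm{NT}(\sigma)$, $\mathrm{NT}(\sigma_1\times\cdots\times\sigma_k)=\prod_i\mathrm{NT}(\sigma_i)$, and $(\mathrm{NT}(\delta_1),\dots,\mathrm{NT}(\delta_n))$ the least tuple with $\mathrm{NT}(\delta_i)=\mathrm{NT}(\sigma_{i1})+\cdots+\mathrm{NT}(\sigma_{im_i})$ (disjoint union with injections $\mathrm{inj}_j$). A ground raw term $p$ denotes $[\![p]\!]$: $[\![a]\!]=a$, $[\![\mathrm{mod}(p,\rho)]\!]=[\![p[\rho]]\!]$, $[\![[a]p]\!]=\langle a\rangle[\![p]\!]$, tuples componentwise, $[\![f_{ij}(p)]\!]=\mathrm{inj}_j[\![p]\!]$.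 NRTSS. A nominal residual signature $(\Delta,A,\sigma,\varrho,F)$ is a nominal signature with distinguished state sort $\sigma$ and residual sort $\varrho$. A formula is $s\to r$ with $s,r$ raw terms of sorts $\sigma,\varrho$; a freshness assertion is $a\not\approx t$ ($a$ an atom, $t$ a raw term); a freshness environment is a finite set of assertions; for a ground substitution $\varphi$ (with all relevant $\varphi(t)$ ground), $\varphi(\nabla)$ holds iff $a\#[\![\varphi(t)]\!]$ for every $a\not\approx t\in\nabla$. A rule $H,\nabla/t\to t'$ consists of a finitely supported set $H$ of formulas (premisses), a freshness environment $\nabla$, and a conclusion formula $t\to t'$; an NRTSS is a set of rules. Permutations act on formulas, assertions and rules componentwise. A proof tree in $\mathcal{R}$ of a transition $P\to R$ (with $P,R$ nominal terms) is a rooted tree without infinite paths, nodes labelled by transitions, root labelled $P\to R$, such that for every node labelled $[\![p]\!]\to[\![p']\!]$ whose children are labelled $\{[\![q_i]\!]\to[\![q_i']\!]\mid i\in I\}$ there are a rule $\{u_i\to u_i'\mid i\in I\},\nabla/t\to t'$ in $\mathcal{R}$ and a ground substitution $\varphi$ with $[\![\varphi(t)]\!]=[\![p]\!]$, $[\![\varphi(t')]\!]=[\![p']\!]$, $[\![\varphi(u_i)]\!]=[\![q_i]\!]$, $[\![\varphi(u_i')]\!]=[\![q_i']\!]$ and $\varphi(\nabla)$ holding. A transition is provable if it has a proof tree. $\mathcal{R}$ is in equivariant format iff $(a\ b)\cdot\mathrm{Ru}\in\mathcal{R}$ for every rule $\mathrm{Ru}\in\mathcal{R}$ and all atoms $a,b$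 (of the same sort). -}

module Defs where

open import Data.Nat using (ℕ; zero; suc)
import Data.Nat.Properties as ℕP
open import Data.Fin using (Fin)
open import Data.List using (List; []; _∷_; _++_)
import Data.List as L
open import Data.List.Membership.Propositional using (_∈_; _∉_)
open import Data.List.Membership.Propositional.Properties using (∈-map⁺; ∈-++⁺ˡ; ∈-++⁺ʳ)
open import Data.List.Relation.Unary.All using (All)
open import Data.List.Relation.Unary.Any using (here; there)
open import Data.Product using (Σ; ∃; _×_; _,_; proj₁; proj₂)
open import Data.Sum using (_⊎_; inj₁; inj₂)
open import Data.Empty using (⊥; ⊥-elim)
open import Data.Unit using (⊤; tt)
open import Function using (_∘_)
open import Relation.Nullary using (¬_; Dec; yes; no)
open import Relation.Binary.Definitions using (DecidableEquality)
open import Relation.Binary.PropositionalEquality using (_≡_; refl; sym; trans; cong)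

record AtomSorts : Set₁ where
  field
    Carrier        : Set
    code           : Carrier → ℕ
    code-injective : ∀ {x y} → code x ≡ code y → x ≡ y

  _≟_ : DecidableEquality Carrier
  x ≟ y with code x ℕP.≟ code y
  ... | yes p = yes (code-injective p)
  ... | no ¬p = no (λ e → ¬p (cong code e))

swapℕ : ℕ → ℕ → ℕ → ℕ
swapℕ a b k with k ℕP.≟ a
... | yes _ = b
... | no _ with k ℕP.≟ b
...   | yes _ = a
...   | no _ = k

swapℕ-a : ∀ a b → swapℕ a b a ≡ b
swapℕ-a a b with a ℕP.≟ a
... | yes _ = refl
... | no ne = ⊥-elim (ne refl)

swapℕ-b : ∀ a b → swapℕ a b b ≡ a
swapℕ-b a b with b ℕP.≟ a
... | yes e = e
... | no _ with b ℕP.≟ b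
...   | yes _ = refl
...   | no ne = ⊥-elim (ne refl)

swapℕ-fix : ∀ a b k → ¬ k ≡ a → ¬ k ≡ b → swapℕ a b k ≡ k
swapℕ-fix a b k na nb with k ℕP.≟ a
... | yes e = ⊥-elim (na e)
... | no _ with k ℕP.≟ b
...   | yes e = ⊥-elim (nb e)
...   | no _ = refl

swapℕ-inv : ∀ a b k → swapℕ a b (swapℕ a b k) ≡ k
swapℕ-inv a b k with k ℕP.≟ a
... | yes e = trans (swapℕ-b a b) (sym e)
... | no na with k ℕP.≟ b
...   | yes e = trans (swapℕ-a a b) (sym e)
...   | no nb = swapℕ-fix a b k na nb

module Atoms (𝒜 : AtomSorts) where
  open AtomSorts 𝒜 renaming (Carrier to AS)

  Atom : Set
  Atom = AS × ℕ

  record Perm : Set where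
    field
      fun     : AS → ℕ → ℕ
      inv     : AS → ℕ → ℕ
      fun-inv : ∀ α k → fun α (inv α k) ≡ k
      inv-fun : ∀ α k → inv α (fun α k) ≡ k
      support : List Atom
      fixes   : ∀ α k → (α , k) ∉ support → fun α k ≡ k

  swapFun : AS → ℕ → ℕ → AS → ℕ → ℕ
  swapFun α a b β k with β ≟ α
  ... | yes _ = swapℕ a b k
  ... | no _ = k

  swapFun-inv : ∀ α a b β k → swapFun α a b β (swapFun α a b β k) ≡ k
  swapFun-inv α a b β k with β ≟ α
  ... | yes _ = swapℕ-inv a b k
  ... | no _ = refl

  swapFun-fix : ∀ α a b β k → (β , k) ∉ ((α , a) ∷ (α , b) ∷ []) → swapFun α a b β k ≡ k
  swapFun-fix α a b β k nm with β ≟ α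
  ... | yes refl = swapℕ-fix a b k (λ e → nm (here (cong (α ,_) e)))
                                   (λ e → nm (there (here (cong (α ,_) e))))
  ... | no _ = refl

  swap : AS → ℕ → ℕ → Perm
  swap α a b = record
    { fun = swapFun α a b ; inv = swapFun α a b
    ; fun-inv = swapFun-inv α a b ; inv-fun = swapFun-inv α a b
    ; support = (α , a) ∷ (α , b) ∷ [] ; fixes = swapFun-fix α a b }

  record Ren : Set where
    field
      fun     : AS → ℕ → ℕ
      support : List Atom
      fixes   : ∀ α k → (α , k) ∉ support → fun α k ≡ k

  idRen : Ren
  idRen = record { fun = λ _ k → k ; support = [] ; fixes = λ _ _ _ → refl }

  -- ρ₁ ⨾ ρ₂ = ρ₂ ∘ ρ₁
  _⨾_ : Ren → Ren → Ren
  ρ₁ ⨾ ρ₂ = record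
    { fun = λ α k → Ren.fun ρ₂ α (Ren.fun ρ₁ α k)
    ; support = Ren.support ρ₁ ++ Ren.support ρ₂
    ; fixes = λ α k nm → trans (cong (Ren.fun ρ₂ α) (Ren.fixes ρ₁ α k (λ x → nm (∈-++⁺ˡ x))))
                               (Ren.fixes ρ₂ α k (λ x → nm (∈-++⁺ʳ (Ren.support ρ₁) x))) }

  -- π · ρ = π⁻¹ ⨾ ρ ⨾ π
  _·ʳ_ : Perm → Ren → Ren
  π ·ʳ ρ = record
    { fun = λ α k → Perm.fun π α (Ren.fun ρ α (Perm.inv π α k))
    ; support = L.map g (Ren.support ρ)
    ; fixes = λ α k nm →
        trans (cong (Perm.fun π α)
                    (Ren.fixes ρ α (Perm.inv π α k)
                      (λ x → nm (subst′ (Perm.fun-inv π α k) (∈-map⁺ g x)))))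
              (Perm.fun-inv π α k) }
    where
    g : Atom → Atom
    g (β , j) = β , Perm.fun π β j
    subst′ : ∀ {α j k} → j ≡ k → (α , j) ∈ L.map g (Ren.support ρ) → (α , k) ∈ L.map g (Ren.support ρ)
    subst′ refl x = x

  data Sort (n : ℕ) : Set where
    base : Fin n → Sort n
    atm  : AS → Sort n
    abs  : AS → Sort n → Sort n
    prod : List (Sort n) → Sort n

  -- function symbols f_ij : arity i j → base i  (1 ≤ i ≤ n, 1 ≤ j ≤ m i)
  record Signature : Set where
    field
      n     : ℕ
      m     : Fin n → ℕ
      arity : (i : Fin n) → Fin (m i) → Sort n

  record ResSignature : Set where
    field
      sig      : Signature
      state    : Sort (Signature.n sig)
      residual : Sort (Signature.n sig)

module Spec (𝒜 : AtomSorts) (S : Atoms.ResSignature 𝒜) where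
  open AtomSorts 𝒜 renaming (Carrier to AS)
  open Atoms 𝒜 public
  open ResSignature S using (sig)
  open Signature sig

  Srt : Set
  Srt = Sort n

  stateSort : Srt
  stateSort = ResSignature.state S

  residualSort : Srt
  residualSort = ResSignature.residual S

  mutual
    data Raw : Srt → Set where
      var  : ∀ {σ} → ℕ → Raw σ
      atom : (α : AS) → ℕ → Raw (atm α)
      mod  : ∀ {σ} → Raw σ → Ren → Raw σ
      absr : ∀ {σ} (α : AS) → ℕ → Raw σ → Raw (abs α σ)
      tup  : ∀ {σs} → Raws σs → Raw (prod σs)
      app  : (i : Fin n) (j : Fin (m i)) → Raw (arity i j) → Raw (base i)

    data Raws : List Srt → Set where
      []  : Raws []
      _∷_ : ∀ {σ σs} → Raw σ → Raws σs → Raws (σ ∷ σs)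

  mutual
    permR : Perm → ∀ {σ} → Raw σ → Raw σ
    permR π (var x) = var x
    permR π (atom α k) = atom α (Perm.fun π α k)
    permR π (mod t ρ) = mod (permR π t) (π ·ʳ ρ)
    permR π (absr α k t) = absr α (Perm.fun π α k) (permR π t)
    permR π (tup ts) = tup (permRs π ts)
    permR π (app i j t) = app i j (permR π t)

    permRs : Perm → ∀ {σs} → Raws σs → Raws σs
    permRs π [] = []
    permRs π (t ∷ ts) = permR π t ∷ permRs π ts

  -- equality of raw terms (renamings, being maps, are compared pointwise)
  _≗ʳ_ : Ren → Ren → Set
  ρ ≗ʳ ρ′ = ∀ α k → Ren.fun ρ α k ≡ Ren.fun ρ′ α k

  mutual
    data _≐_ : ∀ {σ} → Raw σ → Raw σ → Set where
      var≐  : ∀ {σ x} → var {σ} x ≐ var x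
      atom≐ : ∀ {α k} → atom α k ≐ atom α k
      mod≐  : ∀ {σ} {t t′ : Raw σ} {ρ ρ′} → t ≐ t′ → ρ ≗ʳ ρ′ → mod t ρ ≐ mod t′ ρ′
      absr≐ : ∀ {σ α k} {t t′ : Raw σ} → t ≐ t′ → absr α k t ≐ absr α k t′
      tup≐  : ∀ {σs} {ts ts′ : Raws σs} → ts ≐s ts′ → tup ts ≐ tup ts′
      app≐  : ∀ {i j} {t t′ : Raw (arity i j)} → t ≐ t′ → app i j t ≐ app i j t′

    data _≐s_ : ∀ {σs} → Raws σs → Raws σs → Set where
      []  : [] ≐s []
      _∷_ : ∀ {σ σs} {t t′ : Raw σ} {ts ts′ : Raws σs} → t ≐ t′ → ts ≐s ts′ → (t ∷ ts) ≐s (t′ ∷ ts′)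

  mutual
    Ground : ∀ {σ} → Raw σ → Set
    Ground (var x) = ⊥
    Ground (atom α k) = ⊤
    Ground (mod t ρ) = Ground t
    Ground (absr α k t) = Ground t
    Ground (tup ts) = Grounds ts
    Ground (app i j t) = Ground t

    Grounds : ∀ {σs} → Raws σs → Set
    Grounds [] = ⊤
    Grounds (t ∷ ts) = Ground t × Grounds ts

  record GSubst : Set where
    field
      apply   : (σ : Srt) → ℕ → Raw σ
      support : List (Srt × ℕ)
      fixes   : ∀ σ x → (σ , x) ∉ support → apply σ x ≡ var x
      ground  : ∀ σ x → ¬ (apply σ x ≡ var x) → Ground (apply σ x)

  mutual
    sub : GSubst → ∀ {σ} → Raw σ → Raw σ
    sub φ (var {σ} x) = GSubst.apply φ σ x
    sub φ (atom α k) = atom α k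
    sub φ (mod t ρ) = mod (sub φ t) ρ
    sub φ (absr α k t) = absr α k (sub φ t)
    sub φ (tup ts) = tup (subs φ ts)
    sub φ (app i j t) = app i j (sub φ t)

    subs : GSubst → ∀ {σs} → Raws σs → Raws σs
    subs φ [] = []
    subs φ (t ∷ ts) = sub φ t ∷ subs φ ts

  -- nominal terms, represented concretely; equality of nominal terms is
  -- _≈_ below (atom-abstraction equality as sets), freshness via supp.
  mutual
    data NT : Srt → Set where
      at  : ∀ {α} → ℕ → NT (atm α)
      ab  : ∀ {α σ} → ℕ → NT σ → NT (abs α σ)
      tp  : ∀ {σs} → NTs σs → NT (prod σs)
      inj : ∀ {i} (j : Fin (m i)) → NT (arity i j) → NT (base i)

    data NTs : List Srt → Set where
      []  : NTs []
      _∷_ : ∀ {σ σs} → NT σ → NTs σs → NTs (σ ∷ σs)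

  mutual
    actNT : (AS → ℕ → ℕ) → ∀ {σ} → NT σ → NT σ
    actNT f (at {α} k) = at (f α k)
    actNT f (ab {α} k s) = ab (f α k) (actNT f s)
    actNT f (tp ss) = tp (actNTs f ss)
    actNT f (inj j s) = inj j (actNT f s)

    actNTs : (AS → ℕ → ℕ) → ∀ {σs} → NTs σs → NTs σs
    actNTs f [] = []
    actNTs f (s ∷ ss) = actNT f s ∷ actNTs f ss

  permNT : Perm → ∀ {σ} → NT σ → NT σ
  permNT π = actNT (Perm.fun π)

  mutual
    Fresh : AS → ℕ → ∀ {σ} → NT σ → Set
    Fresh α a (at {β} k) = ¬ ((α , a) ≡ (β , k))
    Fresh α a (ab {β} k s) = ((α , a) ≡ (β , k)) ⊎ Fresh α a s
    Fresh α a (tp ss) = Freshs α a ss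
    Fresh α a (inj j s) = Fresh α a s

    Freshs : AS → ℕ → ∀ {σs} → NTs σs → Set
    Freshs α a [] = ⊤
    Freshs α a (s ∷ ss) = Fresh α a s × Freshs α a ss

  mutual
    data _≈_ : ∀ {σ} → NT σ → NT σ → Set where
      at≈   : ∀ {α k} → at {α} k ≈ at k
      ab≈   : ∀ {α σ a} {s t : NT σ} → s ≈ t → ab {α} a s ≈ ab a t
      ab≈′  : ∀ {α σ a b} {s t : NT σ} → Fresh α b s → actNT (swapFun α b a) s ≈ t
              → ab {α} a s ≈ ab b t
      tp≈   : ∀ {σs} {ss tt : NTs σs} → ss ≈s tt → tp ss ≈ tp tt
      inj≈  : ∀ {i j} {s t : NT (arity i j)} → s ≈ t → inj j s ≈ inj j t

    data _≈s_ : ∀ {σs} → NTs σs → NTs σs → Set where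
      []  : [] ≈s []
      _∷_ : ∀ {σ σs} {s t : NT σ} {ss tt : NTs σs} → s ≈ t → ss ≈s tt → (s ∷ ss) ≈s (t ∷ tt)

  -- denotation: den ρ p = ⟦ p [ ρ ] ⟧ for ground p; ⟦ p ⟧ = den idRen p
  mutual
    den : Ren → ∀ {σ} (p : Raw σ) → Ground p → NT σ
    den ρ (var x) ()
    den ρ (atom α k) _ = at (Ren.fun ρ α k)
    den ρ (mod t ρ₁) g = den (ρ₁ ⨾ ρ) t g
    den ρ (absr α k t) g = ab (Ren.fun ρ α k) (den ρ t g)
    den ρ (tup ts) g = tp (dens ρ ts g)
    den ρ (app i j t) g = inj j (den ρ t g)

    dens : Ren → ∀ {σs} (ps : Raws σs) → Grounds ps → NTs σs
    dens ρ [] _ = []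
    dens ρ (t ∷ ts) (g , gs) = den ρ t g ∷ dens ρ ts gs

  ⟦_⟧ : ∀ {σ} (p : Raw σ) → Ground p → NT σ
  ⟦_⟧ = den idRen

  DenotesAs : GSubst → ∀ {σ} → Raw σ → NT σ → Set
  DenotesAs φ t N = Σ (Ground (sub φ t)) λ g → ⟦ sub φ t ⟧ g ≈ N

  record Formula : Set where
    constructor _⟶_
    field
      lhs : Raw stateSort
      rhs : Raw residualSort

  _≐F_ : Formula → Formula → Set
  f ≐F f′ = (Formula.lhs f ≐ Formula.lhs f′) × (Formula.rhs f ≐ Formula.rhs f′)

  record Assertion : Set where
    constructor _≉_
    field
      {asort} : AS
      {tsort} : Srt
      atomIx  : ℕ
      term    : Raw tsort

  record Rule : Set₁ where
    field
      I      : Set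
      prem   : I → Formula
      env    : List Assertion
      concl  : Formula

  permF : Perm → Formula → Formula
  permF π (l ⟶ r) = permR π l ⟶ permR π r

  permA : Perm → Assertion → Assertion
  permA π (_≉_ {α} a t) = _≉_ {α} (Perm.fun π α a) (permR π t)

  permRule : Perm → Rule → Rule
  permRule π Ru = record
    { I = Rule.I Ru
    ; prem = permF π ∘ Rule.prem Ru
    ; env = L.map (permA π) (Rule.env Ru)
    ; concl = permF π (Rule.concl Ru) }

  -- H is finitely supported: some finite set of atoms supports H as a set
  FinSuppPrem : Rule → Set
  FinSuppPrem Ru =
    ∃ λ (B : List Atom) → ∀ (π : Perm) → (∀ α k → (α , k) ∈ B → Perm.fun π α k ≡ k) →
      (∀ i → ∃ λ j → permF π (Rule.prem Ru i) ≐F Rule.prem Ru j) ×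
      (∀ j → ∃ λ i → permF π (Rule.prem Ru i) ≐F Rule.prem Ru j)

  IsNRTSS : (Rule → Set) → Set₁
  IsNRTSS ℛ = ∀ Ru → ℛ Ru → FinSuppPrem Ru

  EquivariantFormat : (Rule → Set) → Set₁
  EquivariantFormat ℛ = ∀ Ru → ℛ Ru → ∀ (α : AS) (a b : ℕ) → ℛ (permRule (swap α a b) Ru)

  HoldsA : GSubst → Assertion → Set
  HoldsA φ (_≉_ {α} a t) = Σ (Ground (sub φ t)) λ g → Fresh α a (⟦ sub φ t ⟧ g)

  data Provable (ℛ : Rule → Set) : NT stateSort → NT residualSort → Set₁ where
    node : ∀ {P P′} (Ru : Rule) → ℛ Ru → (φ : GSubst)
         → (Q : Rule.I Ru → NT stateSort) (Q′ : Rule.I Ru → NT residualSort)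
         → (∀ i → Provable ℛ (Q i) (Q′ i))
         → (∀ i → DenotesAs φ (Formula.lhs (Rule.prem Ru i)) (Q i)
                × DenotesAs φ (Formula.rhs (Rule.prem Ru i)) (Q′ i))
         → DenotesAs φ (Formula.lhs (Rule.concl Ru)) P
         → DenotesAs φ (Formula.rhs (Rule.concl Ru)) P′
         → All (HoldsA φ) (Rule.env Ru)
         → Provable ℛ P P′

module Submission where

open import Defs
open import Level using (Level)
open import Data.Nat using (ℕ)
import Data.Nat.Properties as ℕP
open import Data.List using (List; []; _∷_)
import Data.List as L
open import Data.List.Membership.Propositional using (_∉_)
open import Data.List.Relation.Unary.All using (All; []; _∷_)
open import Data.List.Relation.Unary.Any using (here; there)
open import Data.Product using (_,_; proj₁; proj₂)
open import Data.Sum using (inj₁; inj₂)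
open import Data.Empty using (⊥-elim)
open import Data.Unit using (tt)
open import Function using (_∘_)
open import Function.Definitions using (Injective)
open import Relation.Nullary using (¬_; Dec; yes; no)
open import Relation.Binary.PropositionalEquality
  using (_≡_; refl; sym; trans; cong; cong₂; subst; subst₂; module ≡-Reasoning)

-- A proof tree can be permuted as a whole: the rule is replaced by its
-- permuted instance and the substitution by its permuted version, which is
-- legitimate because permutations commute with substitution, renaming and
-- denotation and preserve freshness and α-equivalence.  So provability is
-- closed under every permutation under which the rule set is closed; the
-- equivariant format gives this for transpositions, and every permutation is
-- a finite composite of transpositions.

module AtomMaps (𝒜 : AtomSorts) where
  open AtomSorts 𝒜 using (_≟_) renaming (Carrier to AS)
  open Atoms 𝒜
  open ≡-Reasoning

  AtomMap : Set
  AtomMap = AS → ℕ → ℕ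

  SortwiseInjective : AtomMap → Set
  SortwiseInjective f = ∀ α → Injective _≡_ _≡_ (f α)

  Perm-injective : (π : Perm) → SortwiseInjective (Perm.fun π)
  Perm-injective π α {a} {b} e = begin
    a                              ≡⟨ sym (Perm.inv-fun π α a) ⟩
    Perm.inv π α (Perm.fun π α a)  ≡⟨ cong (Perm.inv π α) e ⟩
    Perm.inv π α (Perm.fun π α b)  ≡⟨ Perm.inv-fun π α b ⟩
    b                              ∎

  swapFun-same : ∀ α a b k → swapFun α a b α k ≡ swapℕ a b k
  swapFun-same α a b k with α ≟ α
  ... | yes _ = refl
  ... | no α≢α = ⊥-elim (α≢α refl)

  swapFun-other : ∀ {α β} a b k → ¬ β ≡ α → swapFun α a b β k ≡ k
  swapFun-other {α} {β} a b k β≢α with β ≟ α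
  ... | yes β≡α = ⊥-elim (β≢α β≡α)
  ... | no _ = refl

  swapFun-injective : ∀ α a b → SortwiseInjective (swapFun α a b)
  swapFun-injective α a b β {x} {y} e = begin
    x                                       ≡⟨ sym (swapFun-inv α a b β x) ⟩
    swapFun α a b β (swapFun α a b β x)     ≡⟨ cong (swapFun α a b β) e ⟩
    swapFun α a b β (swapFun α a b β y)     ≡⟨ swapFun-inv α a b β y ⟩
    y                                       ∎

  swapℕ-natural : (h : ℕ → ℕ) → Injective _≡_ _≡_ h →
                  ∀ a b k → h (swapℕ a b k) ≡ swapℕ (h a) (h b) (h k)
  swapℕ-natural h h-inj a b k = by-cases (k ℕP.≟ a) (k ℕP.≟ b)
    where
    by-cases : Dec (k ≡ a) → Dec (k ≡ b) → h (swapℕ a b k) ≡ swapℕ (h a) (h b) (h k)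
    by-cases (yes refl) _ = trans (cong h (swapℕ-a k b)) (sym (swapℕ-a (h k) (h b)))
    by-cases (no _) (yes refl) = trans (cong h (swapℕ-b a k)) (sym (swapℕ-b (h a) (h k)))
    by-cases (no k≢a) (no k≢b) =
      trans (cong h (swapℕ-fix a b k k≢a k≢b))
            (sym (swapℕ-fix (h a) (h b) (h k) (k≢a ∘ h-inj) (k≢b ∘ h-inj)))

  swapFun-natural : (f : AtomMap) → SortwiseInjective f → ∀ α a b β k →
                    f β (swapFun α a b β k) ≡ swapFun α (f α a) (f α b) β (f β k)
  swapFun-natural f f-inj α a b β k = by-sort (β ≟ α)
    where
    by-sort : Dec (β ≡ α) → f β (swapFun α a b β k) ≡ swapFun α (f α a) (f α b) β (f β k)
    by-sort (no β≢α) =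
      trans (cong (f β) (swapFun-other a b k β≢α)) (sym (swapFun-other (f α a) (f α b) (f β k) β≢α))
    by-sort (yes refl) = begin
      f β (swapFun β a b β k)               ≡⟨ cong (f β) (swapFun-same β a b k) ⟩
      f β (swapℕ a b k)                     ≡⟨ swapℕ-natural (f β) (f-inj β) a b k ⟩
      swapℕ (f β a) (f β b) (f β k)         ≡⟨ sym (swapFun-same β (f β a) (f β b) (f β k)) ⟩
      swapFun β (f β a) (f β b) β (f β k)   ∎

  record ClosedUnderTranspositions {ℓ : Level} (Q : AtomMap → Set ℓ) : Set ℓ where
    field
      respects-≗ : ∀ {f g} → (∀ α k → f α k ≡ g α k) → Q f → Q g
      holds-id   : Q (λ _ k → k)
      holds-swap : ∀ α a b → Q (swapFun α a b)
      holds-∘    : ∀ {f g} → Q f → Q g → Q (λ α k → f α (g α k))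

  module _ {ℓ : Level} {Q : AtomMap → Set ℓ} (closed : ClosedUnderTranspositions Q) where
    open ClosedUnderTranspositions closed

    -- Induction on the support: composing f with the transposition of a and
    -- f a yields an injection fixing a, hence supported by the rest of the list.
    holds-on-finitely-supported : (B : List Atom) (f : AtomMap) → SortwiseInjective f →
                                  (∀ α k → (α , k) ∉ B → f α k ≡ k) → Q f
    holds-on-finitely-supported [] f _ fixes =
      respects-≗ (λ α k → sym (fixes α k λ ())) holds-id
    holds-on-finitely-supported ((α , a) ∷ B) f f-inj fixes =
      respects-≗ (λ β k → swapFun-inv α a (f α a) β (f β k))
        (holds-∘ (holds-swap α a (f α a))
                 (holds-on-finitely-supported B f′ f′-injective f′-fixes))
      where
      f′ : AtomMap
      f′ β k = swapFun α a (f α a) β (f β k)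

      f′-injective : SortwiseInjective f′
      f′-injective β = f-inj β ∘ swapFun-injective α a (f α a) β

      f′-fixes : ∀ β k → (β , k) ∉ B → f′ β k ≡ k
      f′-fixes β k k∉B = by-cases (β ≟ α) (k ℕP.≟ a)
        where
        by-cases : Dec (β ≡ α) → Dec (k ≡ a) → f′ β k ≡ k
        by-cases (no β≢α) _ =
          trans (swapFun-other a (f α a) (f β k) β≢α)
                (fixes β k λ { (here e) → β≢α (cong proj₁ e) ; (there k∈B) → k∉B k∈B })
        by-cases (yes refl) (yes refl) = trans (swapFun-same β k (f β k) (f β k)) (swapℕ-b k (f β k))
        by-cases (yes refl) (no k≢a) = begin
          swapFun β a (f β a) β (f β k)  ≡⟨ cong (swapFun β a (f β a) β) fk≡k ⟩
          swapFun β a (f β a) β k        ≡⟨ swapFun-same β a (f β a) k ⟩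
          swapℕ a (f β a) k              ≡⟨ swapℕ-fix a (f β a) k k≢a k≢fa ⟩
          k                              ∎
          where
          fk≡k : f β k ≡ k
          fk≡k = fixes β k λ { (here e) → k≢a (cong proj₂ e) ; (there k∈B) → k∉B k∈B }

          k≢fa : ¬ k ≡ f β a
          k≢fa k≡fa = k≢a (f-inj β (trans fk≡k k≡fa))

    holds-on-Perm : (π : Perm) → Q (Perm.fun π)
    holds-on-Perm π =
      holds-on-finitely-supported (Perm.support π) (Perm.fun π) (Perm-injective π) (Perm.fixes π)

module NominalTermActions (𝒜 : AtomSorts) (S : Atoms.ResSignature 𝒜) where
  open Spec 𝒜 S
  open AtomMaps 𝒜

  mutual
    actNT-∘ : (f g : AtomMap) → ∀ {σ} (s : NT σ) →
              actNT f (actNT g s) ≡ actNT (λ α k → f α (g α k)) s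
    actNT-∘ f g (at k) = refl
    actNT-∘ f g (ab k s) = cong (ab _) (actNT-∘ f g s)
    actNT-∘ f g (tp ss) = cong tp (actNTs-∘ f g ss)
    actNT-∘ f g (inj j s) = cong (inj j) (actNT-∘ f g s)

    actNTs-∘ : (f g : AtomMap) → ∀ {σs} (ss : NTs σs) →
               actNTs f (actNTs g ss) ≡ actNTs (λ α k → f α (g α k)) ss
    actNTs-∘ f g [] = refl
    actNTs-∘ f g (s ∷ ss) = cong₂ _∷_ (actNT-∘ f g s) (actNTs-∘ f g ss)

  mutual
    actNT-cong : {f g : AtomMap} → (∀ α k → f α k ≡ g α k) → ∀ {σ} (s : NT σ) → actNT f s ≡ actNT g s
    actNT-cong f≗g (at {α} k) = cong at (f≗g α k)
    actNT-cong f≗g (ab {α} k s) = cong₂ ab (f≗g α k) (actNT-cong f≗g s)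
    actNT-cong f≗g (tp ss) = cong tp (actNTs-cong f≗g ss)
    actNT-cong f≗g (inj j s) = cong (inj j) (actNT-cong f≗g s)

    actNTs-cong : {f g : AtomMap} → (∀ α k → f α k ≡ g α k) → ∀ {σs} (ss : NTs σs) → actNTs f ss ≡ actNTs g ss
    actNTs-cong f≗g [] = refl
    actNTs-cong f≗g (s ∷ ss) = cong₂ _∷_ (actNT-cong f≗g s) (actNTs-cong f≗g ss)

  mutual
    actNT-id : ∀ {σ} (s : NT σ) → actNT (λ _ k → k) s ≡ s
    actNT-id (at k) = refl
    actNT-id (ab k s) = cong (ab k) (actNT-id s)
    actNT-id (tp ss) = cong tp (actNTs-id ss)
    actNT-id (inj j s) = cong (inj j) (actNT-id s)

    actNTs-id : ∀ {σs} (ss : NTs σs) → actNTs (λ _ k → k) ss ≡ ss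
    actNTs-id [] = refl
    actNTs-id (s ∷ ss) = cong₂ _∷_ (actNT-id s) (actNTs-id ss)

  module _ (f : AtomMap) (f-inj : SortwiseInjective f) where
    mutual
      Fresh-actNT : ∀ {α a σ} (s : NT σ) → Fresh α a s → Fresh α (f α a) (actNT f s)
      Fresh-actNT {α} {a} (at {β} k) a≢k fa≡fk = a≢k (unmap (cong proj₁ fa≡fk) (cong proj₂ fa≡fk))
        where
        unmap : α ≡ β → f α a ≡ f β k → (α , a) ≡ (β , k)
        unmap refl fa≡fk = cong (α ,_) (f-inj α fa≡fk)
      Fresh-actNT (ab k s) (inj₁ refl) = inj₁ refl
      Fresh-actNT (ab k s) (inj₂ a#s) = inj₂ (Fresh-actNT s a#s)
      Fresh-actNT (tp ss) a#ss = Freshs-actNTs ss a#ss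
      Fresh-actNT (inj j s) a#s = Fresh-actNT s a#s

      Freshs-actNTs : ∀ {α a σs} (ss : NTs σs) → Freshs α a ss → Freshs α (f α a) (actNTs f ss)
      Freshs-actNTs [] _ = tt
      Freshs-actNTs (s ∷ ss) (a#s , a#ss) = Fresh-actNT s a#s , Freshs-actNTs ss a#ss

    mutual
      ≈-actNT : ∀ {σ} {s t : NT σ} → s ≈ t → actNT f s ≈ actNT f t
      ≈-actNT at≈ = at≈
      ≈-actNT (ab≈ s≈t) = ab≈ (≈-actNT s≈t)
      ≈-actNT (ab≈′ {α} {σ} {a} {b} {s} {t} b#s swapped≈t) =
        ab≈′ (Fresh-actNT s b#s) (subst (_≈ actNT f t) swap-commutes (≈-actNT swapped≈t))
        where
        swap-commutes : actNT f (actNT (swapFun α b a) s) ≡ actNT (swapFun α (f α b) (f α a)) (actNT f s)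
        swap-commutes = begin
          actNT f (actNT (swapFun α b a) s)                     ≡⟨ actNT-∘ f (swapFun α b a) s ⟩
          actNT (λ β k → f β (swapFun α b a β k)) s             ≡⟨ actNT-cong (swapFun-natural f f-inj α b a) s ⟩
          actNT (λ β k → swapFun α (f α b) (f α a) β (f β k)) s ≡⟨ sym (actNT-∘ (swapFun α (f α b) (f α a)) f s) ⟩
          actNT (swapFun α (f α b) (f α a)) (actNT f s)         ∎
          where open ≡-Reasoning
      ≈-actNT (tp≈ ss≈tt) = tp≈ (≈s-actNTs ss≈tt)
      ≈-actNT (inj≈ s≈t) = inj≈ (≈-actNT s≈t)

      ≈s-actNTs : ∀ {σs} {ss tt : NTs σs} → ss ≈s tt → actNTs f ss ≈s actNTs f tt
      ≈s-actNTs [] = []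
      ≈s-actNTs (s≈t ∷ ss≈tt) = ≈-actNT s≈t ∷ ≈s-actNTs ss≈tt

module PermutedProofTrees (𝒜 : AtomSorts) (S : Atoms.ResSignature 𝒜) (π : Atoms.Perm 𝒜) where
  open Spec 𝒜 S
  open AtomMaps 𝒜
  open NominalTermActions 𝒜 S

  private
    πᶠ : AtomMap
    πᶠ = Perm.fun π

  mutual
    Ground-permR : ∀ {σ} (p : Raw σ) → Ground p → Ground (permR π p)
    Ground-permR (var x) ()
    Ground-permR (atom α k) _ = tt
    Ground-permR (mod t ρ) g = Ground-permR t g
    Ground-permR (absr α k t) g = Ground-permR t g
    Ground-permR (tup ts) g = Grounds-permRs ts g
    Ground-permR (app i j t) g = Ground-permR t g

    Grounds-permRs : ∀ {σs} (ps : Raws σs) → Grounds ps → Grounds (permRs π ps)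
    Grounds-permRs [] _ = tt
    Grounds-permRs (t ∷ ts) (g , gs) = Ground-permR t g , Grounds-permRs ts gs

  permGSubst : GSubst → GSubst
  permGSubst φ = record
    { apply = λ σ x → permR π (GSubst.apply φ σ x)
    ; support = GSubst.support φ
    ; fixes = λ σ x x∉ → cong (permR π) (GSubst.fixes φ σ x x∉)
    ; ground = λ σ x moved → Ground-permR (GSubst.apply φ σ x)
                                (GSubst.ground φ σ x (moved ∘ cong (permR π))) }

  mutual
    sub-permR : (φ : GSubst) → ∀ {σ} (t : Raw σ) → sub (permGSubst φ) (permR π t) ≡ permR π (sub φ t)
    sub-permR φ (var x) = refl
    sub-permR φ (atom α k) = refl
    sub-permR φ (mod t ρ) = cong (λ u → mod u (π ·ʳ ρ)) (sub-permR φ t)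
    sub-permR φ (absr α k t) = cong (absr α (πᶠ α k)) (sub-permR φ t)
    sub-permR φ (tup ts) = cong tup (subs-permRs φ ts)
    sub-permR φ (app i j t) = cong (app i j) (sub-permR φ t)

    subs-permRs : (φ : GSubst) → ∀ {σs} (ts : Raws σs) → subs (permGSubst φ) (permRs π ts) ≡ permRs π (subs φ ts)
    subs-permRs φ [] = refl
    subs-permRs φ (t ∷ ts) = cong₂ _∷_ (sub-permR φ t) (subs-permRs φ ts)

  _Conjugates_ : Ren → Ren → Set
  ρ′ Conjugates ρ = ∀ α k → Ren.fun ρ′ α (πᶠ α k) ≡ πᶠ α (Ren.fun ρ α k)

  ⨾-Conjugates : ∀ {ρ ρ′} ρ₁ → ρ′ Conjugates ρ → ((π ·ʳ ρ₁) ⨾ ρ′) Conjugates (ρ₁ ⨾ ρ)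
  ⨾-Conjugates {ρ′ = ρ′} ρ₁ conj α k =
    trans (cong (λ j → Ren.fun ρ′ α (πᶠ α (Ren.fun ρ₁ α j))) (Perm.inv-fun π α k))
          (conj α (Ren.fun ρ₁ α k))

  mutual
    den-permR : ∀ {ρ ρ′} → ρ′ Conjugates ρ → ∀ {σ} (p : Raw σ) (g : Ground p) (g′ : Ground (permR π p)) →
                den ρ′ (permR π p) g′ ≡ permNT π (den ρ p g)
    den-permR conj (var x) () _
    den-permR conj (atom α k) _ _ = cong at (conj α k)
    den-permR {ρ} {ρ′} conj (mod t ρ₁) g g′ =
      den-permR (⨾-Conjugates {ρ} {ρ′} ρ₁ conj) t g g′
    den-permR conj (absr α k t) g g′ = cong₂ ab (conj α k) (den-permR conj t g g′)
    den-permR conj (tup ts) g g′ = cong tp (dens-permRs conj ts g g′)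
    den-permR conj (app i j t) g g′ = cong (inj j) (den-permR conj t g g′)

    dens-permRs : ∀ {ρ ρ′} → ρ′ Conjugates ρ → ∀ {σs} (ps : Raws σs) (g : Grounds ps) (g′ : Grounds (permRs π ps)) →
                  dens ρ′ (permRs π ps) g′ ≡ actNTs πᶠ (dens ρ ps g)
    dens-permRs conj [] _ _ = refl
    dens-permRs conj (t ∷ ts) (g , gs) (g′ , gs′) = cong₂ _∷_ (den-permR conj t g g′) (dens-permRs conj ts gs gs′)

  ⟦⟧-permR : ∀ {σ} (p : Raw σ) (g : Ground p) → ⟦ permR π p ⟧ (Ground-permR p g) ≡ permNT π (⟦ p ⟧ g)
  ⟦⟧-permR p g = den-permR {idRen} {idRen} (λ _ _ → refl) p g (Ground-permR p g)

  DenotesAs-perm : (φ : GSubst) → ∀ {σ} (t : Raw σ) {N : NT σ} →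
                   DenotesAs φ t N → DenotesAs (permGSubst φ) (permR π t) (permNT π N)
  DenotesAs-perm φ t {N} (g , ⟦φt⟧≈N) rewrite sub-permR φ t =
    Ground-permR (sub φ t) g ,
    subst (_≈ permNT π N) (sym (⟦⟧-permR (sub φ t) g)) (≈-actNT πᶠ (Perm-injective π) ⟦φt⟧≈N)

  HoldsA-perm : (φ : GSubst) (A : Assertion) → HoldsA φ A → HoldsA (permGSubst φ) (permA π A)
  HoldsA-perm φ (_≉_ {α} a t) (g , a#φt) rewrite sub-permR φ t =
    Ground-permR (sub φ t) g ,
    subst (Fresh α (πᶠ α a)) (sym (⟦⟧-permR (sub φ t) g))
      (Fresh-actNT πᶠ (Perm-injective π) (⟦ sub φ t ⟧ g) a#φt)

  All-HoldsA-perm : (φ : GSubst) (∇ : List Assertion) →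
                    All (HoldsA φ) ∇ → All (HoldsA (permGSubst φ)) (L.map (permA π) ∇)
  All-HoldsA-perm φ [] [] = []
  All-HoldsA-perm φ (A ∷ ∇) (φA ∷ φ∇) = HoldsA-perm φ A φA ∷ All-HoldsA-perm φ ∇ φ∇

  Provable-perm : {ℛ : Rule → Set} → (∀ Ru → ℛ Ru → ℛ (permRule π Ru)) →
                  ∀ {P R} → Provable ℛ P R → Provable ℛ (permNT π P) (permNT π R)
  Provable-perm ℛ-closed (node Ru Ru∈ℛ φ Q Q′ subproofs premisses lhs rhs ∇) =
    node (permRule π Ru) (ℛ-closed Ru Ru∈ℛ) (permGSubst φ) (permNT π ∘ Q) (permNT π ∘ Q′)
      (λ i → Provable-perm ℛ-closed (subproofs i))
      (λ i → DenotesAs-perm φ (Formula.lhs (Rule.prem Ru i)) (proj₁ (premisses i))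
           , DenotesAs-perm φ (Formula.rhs (Rule.prem Ru i)) (proj₂ (premisses i)))
      (DenotesAs-perm φ (Formula.lhs (Rule.concl Ru)) lhs)
      (DenotesAs-perm φ (Formula.rhs (Rule.concl Ru)) rhs)
      (All-HoldsA-perm φ (Rule.env Ru) ∇)

module ProvabilityUnderAtomMaps (𝒜 : AtomSorts) (S : Atoms.ResSignature 𝒜) (ℛ : Spec.Rule 𝒜 S → Set) where
  open Spec 𝒜 S
  open AtomMaps 𝒜
  open NominalTermActions 𝒜 S

  PreservesProvability : AtomMap → Set₁
  PreservesProvability f = ∀ {P R} → Provable ℛ P R → Provable ℛ (actNT f P) (actNT f R)

  PreservesProvability-closed : EquivariantFormat ℛ → ClosedUnderTranspositions PreservesProvability
  PreservesProvability-closed equivariant = record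
    { respects-≗ = λ f≗g f-preserves {P} {R} →
        subst₂ (Provable ℛ) (actNT-cong f≗g P) (actNT-cong f≗g R) ∘ f-preserves
    ; holds-id = λ {P} {R} → subst₂ (Provable ℛ) (sym (actNT-id P)) (sym (actNT-id R))
    ; holds-swap = λ α a b →
        PermutedProofTrees.Provable-perm 𝒜 S (swap α a b) (λ Ru Ru∈ℛ → equivariant Ru Ru∈ℛ α a b)
    ; holds-∘ = λ {f} {g} f-preserves g-preserves {P} {R} →
        subst₂ (Provable ℛ) (actNT-∘ f g P) (actNT-∘ f g R) ∘ f-preserves ∘ g-preserves
    }

theorem5p3 : (𝒜 : AtomSorts) (S : Atoms.ResSignature 𝒜) →
    let open Spec 𝒜 S in
    (ℛ : Rule → Set) → IsNRTSS ℛ → EquivariantFormat ℛ →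
    (π : Perm) (P : NT stateSort) (R : NT residualSort) →
    Provable ℛ P R → Provable ℛ (permNT π P) (permNT π R)
theorem5p3 𝒜 S ℛ _ equivariant π _ _ =
  AtomMaps.holds-on-Perm 𝒜 (PreservesProvability-closed equivariant) π
  where open ProvabilityUnderAtomMaps 𝒜 S ℛ
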